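{- For Boolean kits $\underline{\mathbb{A}}=(\mathbb{A},\mathcal{A})$ and $\underline{\mathbb{B}}=(\mathbb{B},\mathcal{B})$, the Boolean kits $\underline{\mathbb{A}}\multimap\underline{\mathbb{B}}$ and $(\underline{\mathbb{A}}\otimes\underline{\mathbb{B}}^\perp)^\perp$ are isomorphic.
   Context: A kit on a groupoid $\mathbb{A}$ is a family $\mathcal{A}(a)$ of sets of subgroups of $\mathrm{End}(a)=\mathbb{A}(a,a)$ closed under conjugation. Subgroups $H,K$ of $\mathrm{End}(a)$ are orthogonal if $H\cap K=\{\mathrm{id}\}$; for a family $\mathcal{K}$ of sets of subgroups, $\mathcal{K}^\perp(a)$ is the set of subgroups orthogonal to all members of $\mathcal{K}(a)$. A kit is Boolean if $\mathcal{A}=\mathcal{A}^{\perp\perp}$; $(\mathbb{A},\mathcal{A})^\perp=(\mathbb{A}^{op},\mathcal{A}^\perp)$. $\bigcup\mathcal{A}(a)$ is the union of members. Tensor: $(\mathbb{A},\mathcal{A})\otimes(\mathbb{B},\mathcal{B})=(\mathbb{A}\times\mathbb{B},(\mathcal{A}\times\mathcal{B})^{\perp\perp})$ where $(\mathcal{A}\times\mathcal{B})(a,b)=\{H\times K:H\in\mathcal{A}(a),K\in\mathcal{B}(b)\}$. Linear arrow: $\underline{\mathbb{A}}\multimap\underline{\mathbb{B}}=(\mathbb{A}^{op}\times\mathbb{B},\mathcal{A}\multimap\mathcal{B})$, where $(\mathcal{A}\multimap\mathcal{B})(a,b)$ is the set of subgroups $H\le\mathrm{End}(a,b)$ such that for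 all $(\alpha,\beta)\in H$, $\alpha\in\bigcup\mathcal{A}(a)\Rightarrow\beta\in\bigcup\mathcal{B}(b)$ and $\beta\in\bigcup\mathcal{B}^\perp(b)\Rightarrow\alpha\in\bigcup\mathcal{A}^\perp(a)$ (this is a Boolean kit). -}

module Defs where

open import Level using (Level; _⊔_; 0ℓ) renaming (suc to lsuc)
open import Data.Product using (Σ; ∃; _×_; _,_; proj₁; proj₂)
open import Relation.Binary.PropositionalEquality using (_≡_; refl; sym; trans; cong; cong₂)
open import Relation.Unary using (Pred)
open import Function.Bundles using (_⇔_)
open import Function.Definitions using (Bijective)

record Groupoid : Set₁ where
  infixr 9 _∘_
  field
    Obj   : Set
    Hom   : Obj → Obj → Set
    id    : ∀ {a} → Hom a a
    _∘_   : ∀ {a b c} → Hom b c → Hom a b → Hom a c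
    inv   : ∀ {a b} → Hom a b → Hom b a
    assoc : ∀ {a b c d} (f : Hom c d) (g : Hom b c) (h : Hom a b) →
            (f ∘ g) ∘ h ≡ f ∘ (g ∘ h)
    idˡ   : ∀ {a b} (f : Hom a b) → id ∘ f ≡ f
    idʳ   : ∀ {a b} (f : Hom a b) → f ∘ id ≡ f
    invˡ  : ∀ {a b} (f : Hom a b) → inv f ∘ f ≡ id
    invʳ  : ∀ {a b} (f : Hom a b) → f ∘ inv f ≡ id

open Groupoid public

End : (G : Groupoid) → Obj G → Set
End G a = Hom G a a

op : Groupoid → Groupoid
op G = record
  { Obj = Obj G
  ; Hom = λ a b → Hom G b a
  ; id = id G
  ; _∘_ = λ f g → _∘_ G g f
  ; inv = inv G
  ; assoc = λ f g h → sym (assoc G h g f)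
  ; idˡ = idʳ G
  ; idʳ = idˡ G
  ; invˡ = invʳ G
  ; invʳ = invˡ G
  }

infixr 6 _×G_
_×G_ : Groupoid → Groupoid → Groupoid
G ×G H = record
  { Obj = Obj G × Obj H
  ; Hom = λ { (a , b) (a' , b') → Hom G a a' × Hom H b b' }
  ; id = id G , id H
  ; _∘_ = λ { (f , f') (g , g') → _∘_ G f g , _∘_ H f' g' }
  ; inv = λ { (f , f') → inv G f , inv H f' }
  ; assoc = λ { (f , f') (g , g') (h , h') → cong₂ _,_ (assoc G f g h) (assoc H f' g' h') }
  ; idˡ = λ { (f , f') → cong₂ _,_ (idˡ G f) (idˡ H f') }
  ; idʳ = λ { (f , f') → cong₂ _,_ (idʳ G f) (idʳ H f') }
  ; invˡ = λ { (f , f') → cong₂ _,_ (invˡ G f) (invˡ H f') }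
  ; invʳ = λ { (f , f') → cong₂ _,_ (invʳ G f) (invʳ H f') }
  }

record IsSubgroup (G : Groupoid) (a : Obj G) (H : Pred (End G a) 0ℓ) : Set where
  field
    has-id   : H (id G)
    closed-∘ : ∀ {f g} → H f → H g → H (_∘_ G f g)
    closed-⁻ : ∀ {f} → H f → H (inv G f)

Fam : (G : Groupoid) (k : Level) → Set (lsuc 0ℓ ⊔ lsuc k)
Fam G k = (a : Obj G) → Pred (End G a) 0ℓ → Set k

conj : (G : Groupoid) {a b : Obj G} → Hom G a b → Pred (End G a) 0ℓ → Pred (End G b) 0ℓ
conj G f H β = ∃ λ α → H α × β ≡ _∘_ G f (_∘_ G α (inv G f))

record IsKit {k} (G : Groupoid) (A : Fam G k) : Set (lsuc 0ℓ ⊔ k) where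
  field
    subgroup : ∀ a H → A a H → IsSubgroup G a H
    conj-closed : ∀ {a b} (f : Hom G a b) H → A a H → A b (conj G f H)

Orth : (G : Groupoid) (a : Obj G) → Pred (End G a) 0ℓ → Pred (End G a) 0ℓ → Set
Orth G a H K = ∀ α → H α → K α → α ≡ id G

perp : ∀ {k} (G : Groupoid) → Fam G k → Fam G (lsuc 0ℓ ⊔ k)
perp G A a K = IsSubgroup G a K × (∀ H → A a H → Orth G a H K)

-- 𝒜^⊥ lives on 𝔸^op; 𝒜^⊥⊥ on (𝔸^op)^op (whose End(a) is that of 𝔸)
_⊥ : ∀ {k} {G : Groupoid} → Fam G k → Fam (op G) (lsuc 0ℓ ⊔ k)
_⊥ {G = G} A = perp (op G) A

_⊥⊥ : ∀ {k} {G : Groupoid} → Fam G k → Fam G (lsuc 0ℓ ⊔ k)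
_⊥⊥ {G = G} A = perp (op (op G)) (perp (op G) A)

IsBoolean : ∀ {k} (G : Groupoid) → Fam G k → Set (lsuc 0ℓ ⊔ k)
IsBoolean G A = IsKit G A × (∀ a H → A a H ⇔ _⊥⊥ {G = G} A a H)

⋃ : ∀ {k} {G : Groupoid} → Fam G k → (a : Obj G) → Pred (End G a) (lsuc 0ℓ ⊔ k)
⋃ {G = G} A a α = ∃ λ (H : Pred (End G a) 0ℓ) → A a H × H α

_×F_ : ∀ {k l} {G G' : Groupoid} → Fam G k → Fam G' l → Fam (G ×G G') (lsuc 0ℓ ⊔ k ⊔ l)
_×F_ {G = G} {G' = G'} A B (a , b) P =
  ∃ λ (H : Pred (End G a) 0ℓ) → ∃ λ (K : Pred (End G' b) 0ℓ) → A a H × B b K × (∀ α β → P (α , β) ⇔ (H α × K β))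

tensorFam : ∀ {k l} {G G' : Groupoid} → Fam G k → Fam G' l → Fam (G ×G G') (lsuc 0ℓ ⊔ k ⊔ l)
tensorFam {G = G} {G' = G'} A B = _⊥⊥ {G = G ×G G'} (_×F_ {G = G} {G' = G'} A B)

lolliFam : ∀ {k l} {G G' : Groupoid} → Fam G k → Fam G' l → Fam (op G ×G G') (lsuc 0ℓ ⊔ k ⊔ l)
lolliFam {G = G} {G' = G'} A B (a , b) P =
  IsSubgroup (op G ×G G') (a , b) P ×
  (∀ α β → P (α , β) →
     (⋃ {G = G} A a α → ⋃ {G = G'} B b β) ×
     (⋃ {G = op G'} (_⊥ {G = G'} B) b β → ⋃ {G = op G} (_⊥ {G = G} A) a α))

record Functor (G H : Groupoid) : Set where
  field
    F₀   : Obj G → Obj H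
    F₁   : ∀ {a b} → Hom G a b → Hom H (F₀ a) (F₀ b)
    F-id : ∀ {a} → F₁ (id G {a}) ≡ id H
    F-∘  : ∀ {a b c} (f : Hom G b c) (g : Hom G a b) → F₁ (_∘_ G f g) ≡ _∘_ H (F₁ f) (F₁ g)

open Functor public

record GroupoidIso (G H : Groupoid) : Set where
  field
    functor : Functor G H
    bij₀ : Bijective _≡_ _≡_ (F₀ functor)
    bij₁ : ∀ {a b} → Bijective _≡_ _≡_ (F₁ functor {a} {b})

open GroupoidIso public

image : ∀ {G H} (F : Functor G H) (a : Obj G) → Pred (End G a) 0ℓ → Pred (End H (F₀ F a)) 0ℓ
image F a P β = ∃ λ α → P α × F₁ F α ≡ β

preimage : ∀ {G H} (F : Functor G H) (a : Obj G) → Pred (End H (F₀ F a)) 0ℓ → Pred (End G a) 0ℓ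
preimage F a Q α = Q (F₁ F α)

record KitIso {k l} (G : Groupoid) (A : Fam G k) (H : Groupoid) (B : Fam H l)
       : Set (lsuc 0ℓ ⊔ k ⊔ l) where
  field
    iso  : GroupoidIso G H
    fwd  : ∀ a P → A a P → B (F₀ (functor iso) a) (image (functor iso) a P)
    bwd  : ∀ a Q → B (F₀ (functor iso) a) Q → A a (preimage (functor iso) a Q)

-- A member P of 𝒜 ⊸ ℬ is orthogonal to every H × K with H ∈ 𝒜 and K ∈ ℬ^⊥:
-- if (α , β) ∈ P with α ∈ H and β ∈ K, then β ∈ ⋃ℬ forces β = id, and dually
-- α ∈ ⋃𝒜^⊥ forces α = id. So P ∈ (𝒜 × ℬ^⊥)^⊥ ⊆ (𝒜 × ℬ^⊥)^⊥⊥⊥ = (𝒜 ⊗ ℬ^⊥)^⊥.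
-- Conversely a member Q of (𝒜 × ℬ^⊥)^⊥⊥⊥ is orthogonal to every H × K, so for
-- H ∈ 𝒜 the relational image Q[H] is a subgroup orthogonal to all of ℬ^⊥, hence
-- lies in ℬ^⊥⊥ = ℬ; dually the inverse image of K ∈ ℬ^⊥ lies in 𝒜^⊥.
-- The underlying groupoids (𝔸 × 𝔹^op)^op and 𝔸^op × 𝔹 coincide on the nose.

module Submission where

open import Level using (Level; 0ℓ)
open import Defs
open import Data.Product using (∃; _×_; _,_; proj₁; proj₂)
open import Relation.Binary.PropositionalEquality
  using (_≡_; refl; sym; cong; cong₂; subst; module ≡-Reasoning)
open import Function.Bundles using (Equivalence)
open import Function.Construct.Identity using (bijective; ⇔-id)
open import Relation.Unary using (Pred; _⟨×⟩_)

open IsSubgroup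

IsSubgroup-op : ∀ {G a H} → IsSubgroup G a H → IsSubgroup (op G) a H
IsSubgroup-op s = record
  { has-id = has-id s
  ; closed-∘ = λ p q → closed-∘ s q p
  ; closed-⁻ = closed-⁻ s }

IsSubgroup-unop : ∀ {G a H} → IsSubgroup (op G) a H → IsSubgroup G a H
IsSubgroup-unop s = record
  { has-id = has-id s
  ; closed-∘ = λ p q → closed-∘ s q p
  ; closed-⁻ = closed-⁻ s }

IsSubgroup-opop : ∀ {G a H} → IsSubgroup G a H → IsSubgroup (op (op G)) a H
IsSubgroup-opop s = IsSubgroup-op (IsSubgroup-op s)

IsSubgroup-× : ∀ {G G' a b H K} → IsSubgroup G a H → IsSubgroup G' b K →
               IsSubgroup (G ×G G') (a , b) (H ⟨×⟩ K)
IsSubgroup-× s t = record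
  { has-id = has-id s , has-id t
  ; closed-∘ = λ (p , p') (q , q') → closed-∘ s p q , closed-∘ t p' q'
  ; closed-⁻ = λ (p , p') → closed-⁻ s p , closed-⁻ t p' }

F-inv : ∀ {G H} (F : Functor G H) {a b} (f : Hom G a b) →
        F₁ F (inv G f) ≡ inv H (F₁ F f)
F-inv {G} {H} F f = begin
  F₁ F (inv G f)                                    ≡⟨ sym (idʳ H _) ⟩
  F₁ F (inv G f) ∘H id H                            ≡⟨ cong (F₁ F (inv G f) ∘H_) (sym (invʳ H (F₁ F f))) ⟩
  F₁ F (inv G f) ∘H (F₁ F f ∘H inv H (F₁ F f))      ≡⟨ sym (assoc H _ _ _) ⟩
  (F₁ F (inv G f) ∘H F₁ F f) ∘H inv H (F₁ F f)      ≡⟨ cong (_∘H inv H (F₁ F f)) (sym (F-∘ F (inv G f) f)) ⟩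
  F₁ F (_∘_ G (inv G f) f) ∘H inv H (F₁ F f)        ≡⟨ cong (λ g → F₁ F g ∘H inv H (F₁ F f)) (invˡ G f) ⟩
  F₁ F (id G) ∘H inv H (F₁ F f)                     ≡⟨ cong (_∘H inv H (F₁ F f)) (F-id F) ⟩
  id H ∘H inv H (F₁ F f)                            ≡⟨ idˡ H _ ⟩
  inv H (F₁ F f)                                    ∎
  where
  open ≡-Reasoning
  _∘H_ : ∀ {x y z} → Hom H y z → Hom H x y → Hom H x z
  _∘H_ = _∘_ H

image-IsSubgroup : ∀ {G H} (F : Functor G H) {a P} →
                   IsSubgroup G a P → IsSubgroup H (F₀ F a) (image F a P)
image-IsSubgroup F s = record
  { has-id = _ , has-id s , F-id F
  ; closed-∘ = λ { (α , p , refl) (β , q , refl) → _ , closed-∘ s p q , F-∘ F α β }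
  ; closed-⁻ = λ { (α , p , refl) → _ , closed-⁻ s p , F-inv F α } }

preimage-IsSubgroup : ∀ {G H} (F : Functor G H) {a Q} →
                      IsSubgroup H (F₀ F a) Q → IsSubgroup G a (preimage F a Q)
preimage-IsSubgroup F {Q = Q} s = record
  { has-id = subst Q (sym (F-id F)) (has-id s)
  ; closed-∘ = λ {α} {β} p q → subst Q (sym (F-∘ F α β)) (closed-∘ s p q)
  ; closed-⁻ = λ {α} p → subst Q (sym (F-inv F α)) (closed-⁻ s p) }

directImage : ∀ {X Y : Set} → Pred (X × Y) 0ℓ → Pred X 0ℓ → Pred Y 0ℓ
directImage Q H y = ∃ λ x → H x × Q (x , y)

inverseImage : ∀ {X Y : Set} → Pred (X × Y) 0ℓ → Pred Y 0ℓ → Pred X 0ℓ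
inverseImage Q K x = ∃ λ y → K y × Q (x , y)

module _ {G G' : Groupoid} {a b} {Q : Pred (End (G ×G G') (a , b)) 0ℓ}
         (subgroupQ : IsSubgroup (G ×G G') (a , b) Q) where

  directImage-IsSubgroup : ∀ {H} → IsSubgroup G a H → IsSubgroup G' b (directImage Q H)
  directImage-IsSubgroup s = record
    { has-id = _ , has-id s , has-id subgroupQ
    ; closed-∘ = λ (_ , h , q) (_ , h' , q') → _ , closed-∘ s h h' , closed-∘ subgroupQ q q'
    ; closed-⁻ = λ (_ , h , q) → _ , closed-⁻ s h , closed-⁻ subgroupQ q }

  inverseImage-IsSubgroup : ∀ {K} → IsSubgroup G' b K → IsSubgroup G a (inverseImage Q K)
  inverseImage-IsSubgroup t = record
    { has-id = _ , has-id t , has-id subgroupQ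
    ; closed-∘ = λ (_ , k , q) (_ , k' , q') → _ , closed-∘ t k k' , closed-∘ subgroupQ q q'
    ; closed-⁻ = λ (_ , k , q) → _ , closed-⁻ t k , closed-⁻ subgroupQ q }

module _ {G G' : Groupoid} {a b} {Q : Pred (End (G ×G G') (a , b)) 0ℓ} {H K}
         (orth : Orth (G ×G G') (a , b) (H ⟨×⟩ K) Q) where

  directImage-Orth : Orth G' b K (directImage Q H)
  directImage-Orth β kβ (α , hα , q) = cong proj₂ (orth (α , β) (hα , kβ) q)

  inverseImage-Orth : Orth G a H (inverseImage Q K)
  inverseImage-Orth α hα (β , kβ , q) = cong proj₁ (orth (α , β) (hα , kβ) q)

⊥⇒⊥⊥⊥ : ∀ {k G} {A : Fam G k} {a P} → _⊥ {G = G} A a P → _⊥ {G = G} (_⊥⊥ {G = G} A) a P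
⊥⇒⊥⊥⊥ ⊥P@(subgroupP , _) = subgroupP , λ Q (_ , orthQ) α qα pα → orthQ _ ⊥P α pα qα

⊥⊥⊥⇒Orth : ∀ {k G} {A : Fam G k} {a H Q} → IsSubgroup (op (op G)) a H → A a H →
           _⊥ {G = G} (_⊥⊥ {G = G} A) a Q → Orth G a H Q
⊥⊥⊥⇒Orth subgroupH aH (_ , orthQ) =
  orthQ _ (subgroupH , λ K (_ , orthK) α kα hα → orthK _ aH α hα kα)

op-×-functor : (G G' : Groupoid) → Functor (op G ×G G') (op (G ×G op G'))
op-×-functor G G' = record { F₀ = λ x → x ; F₁ = λ f → f ; F-id = refl ; F-∘ = λ _ _ → refl }

op-×-iso : (G G' : Groupoid) → GroupoidIso (op G ×G G') (op (G ×G op G'))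
op-×-iso G G' = record
  { functor = op-×-functor G G'
  ; bij₀ = bijective _≡_
  ; bij₁ = bijective _≡_ }

module _ {k l} {G G' : Groupoid} {A : Fam G k} {B : Fam G' l} where

  private
    F : Functor (op G ×G G') (op (G ×G op G'))
    F = op-×-functor G G'

    A×B⊥ A⊗B⊥ : Fam (G ×G op G') _
    A×B⊥ = _×F_ {G = G} {G' = op G'} A (_⊥ {G = G'} B)
    A⊗B⊥ = tensorFam {G = G} {G' = op G'} A (_⊥ {G = G'} B)

  lolli-Orth-×F : ∀ {a b P P'} → lolliFam {G = G} {G' = G'} A B (a , b) P →
                  A×B⊥ (a , b) P' → Orth (G ×G op G') (a , b) P' P
  lolli-Orth-×F (_ , arrow) (H , K , aH , ⊥K@(_ , orthK) , P'≡H×K) (α , β) p' p =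
    let hα , kβ = Equivalence.to (P'≡H×K α β) p'
        preserve , reflect = arrow α β p
        L , bL , lβ = preserve (H , aH , hα)
        M , (_ , orthM) , mα = reflect (K , ⊥K , kβ)
    in cong₂ _,_ (orthM H aH α hα mα) (orthK L bL β lβ kβ)

  lolli⇒⊥⊗ : ∀ {a b P} → lolliFam {G = G} {G' = G'} A B (a , b) P →
             _⊥ {G = G ×G op G'} A⊗B⊥ (a , b) (image F (a , b) P)
  lolli⇒⊥⊗ lolliP@(subgroupP , _) = ⊥⇒⊥⊥⊥ {A = A×B⊥}
    ( image-IsSubgroup F subgroupP
    , λ { _ ×P' γ p'γ (.γ , pγ , refl) → lolli-Orth-×F lolliP ×P' γ p'γ pγ } )

  ⊥⊗⇒lolli : IsBoolean G A → IsBoolean G' B → ∀ {a b Q} →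
             _⊥ {G = G ×G op G'} A⊗B⊥ (a , b) Q →
             lolliFam {G = G} {G' = G'} A B (a , b) (preimage F (a , b) Q)
  ⊥⊗⇒lolli (kitA , _) (_ , booleanB) {a} {b} {Q} ⊥⊗Q =
    subgroupQ , λ α β q → preserve α β q , reflect α β q
    where
    subgroupQ : IsSubgroup (op G ×G G') (a , b) Q
    subgroupQ = preimage-IsSubgroup F (proj₁ ⊥⊗Q)

    subgroupA : ∀ {H} → A a H → IsSubgroup G a H
    subgroupA = IsKit.subgroup kitA _ _

    orth : ∀ {H K} → A a H → _⊥ {G = G'} B b K → Orth (G ×G op G') (a , b) (H ⟨×⟩ K) Q
    orth aH ⊥K = ⊥⊥⊥⇒Orth {A = A×B⊥}
      (IsSubgroup-opop (IsSubgroup-× (subgroupA aH) (proj₁ ⊥K)))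
      (_ , _ , aH , ⊥K , λ _ _ → ⇔-id _) ⊥⊗Q

    preserve : ∀ α β → Q (α , β) → ⋃ {G = G} A a α → ⋃ {G = G'} B b β
    preserve α β q (H , aH , hα) =
      directImage Q H ,
      Equivalence.from (booleanB b _)
        ( IsSubgroup-opop (directImage-IsSubgroup subgroupQ (IsSubgroup-op (subgroupA aH)))
        , λ K ⊥K → directImage-Orth {G = G} {G' = op G'} (orth aH ⊥K) ) ,
      (α , hα , q)

    reflect : ∀ α β → Q (α , β) →
              ⋃ {G = op G'} (_⊥ {G = G'} B) b β → ⋃ {G = op G} (_⊥ {G = G} A) a α
    reflect α β q (K , ⊥K , kβ) =
      inverseImage Q K ,
      ( inverseImage-IsSubgroup subgroupQ (IsSubgroup-unop (proj₁ ⊥K))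
      , λ H aH → inverseImage-Orth {G = G} {G' = op G'} (orth aH ⊥K) ) ,
      (β , kβ , q)

lemma5p4 : ∀ {k l : Level} (G G' : Groupoid) (A : Fam G k) (B : Fam G' l) →
    IsBoolean G A → IsBoolean G' B →
    KitIso (op G ×G G') (lolliFam {G = G} {G' = G'} A B)
           (op (G ×G op G')) (_⊥ {G = G ×G op G'} (tensorFam {G = G} {G' = op G'} A (_⊥ {G = G'} B)))
lemma5p4 G G' A B booleanA booleanB = record
  { iso = op-×-iso G G'
  ; fwd = λ _ _ → lolli⇒⊥⊗ {A = A} {B = B}
  ; bwd = λ _ _ → ⊥⊗⇒lolli booleanA booleanB }
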